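{- For all predicates $s, s_1, s_2$ on the state, functions $\sigma:\Sigma\to\Sigma$, and trace expressions $t, t_1, t_2$: (1) $\Phi(s,\sigma,t) \,\mathbf{wp}_r\, \mathit{false} = \mathcal{I}(s,t)$; (2) $\Phi(s_1,\sigma,t_1)\,\mathbf{wp}_r\,\mathcal{I}(s_2,t_2) = \mathcal{I}(s_1\wedge \sigma\dagger s_2,\ t_1{}^\frown(\sigma\dagger t_2))$; (3) $\mathcal{I}(\mathit{false}, t) = \mathit{true}_r$; (4) $\mathcal{I}(\mathit{true},\langle\rangle) = \mathit{false}$; (5) $\mathcal{I}(s_1,t)\wedge\mathcal{I}(s_2,t) = \mathcal{I}(s_1\vee s_2, t)$; (6) $\mathcal{I}(s_1,t)\vee\mathcal{I}(s_2,t) = \mathcal{I}(s_1\wedge s_2, t)$.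
   Context: UTP setting: relations are predicates over undashed (initial) and dashed (final) variables; $;$ is relational composition; $P \lhd c \rhd Q = (c\wedge P)\vee(\neg c\wedge Q)$. Observational variables: booleans $ok,ok',wait,wait'$; traces $tr,tr'$ (finite sequences of events; $\le$ prefix, ${}^\frown$ concatenation, $-$ removal of a prefix); state $st,st'\in\Sigma$; refusal sets $ref,ref'$. $tt$ abbreviates $tr'-tr$. $\mathbf{R1}(P) = P\wedge tr\le tr'$; $\mathbf{R2}(P) = P[\langle\rangle,tr'-tr/tr,tr']\lhd tr\le tr'\rhd P$; $\mathbf{RR}(P) = \exists ok,ok',wait,wait'\bullet\mathbf{R1}(\mathbf{R2}(P))$; $\mathbf{RC}(P) = \mathbf{R1}(\mathbf{RR}(P);(tr'\le tr))$; $\mathbf{CRR}(P)=\exists ref\bullet\mathbf{RR}(P)$; $\mathbf{CRC}(P) = \exists ref\bullet\mathbf{RC}(P)$. $\mathit{true}_r = \mathbf{R1}(\mathit{true})$, $\neg_r P = \mathbf{R1}(\neg P)$, $P\Rightarrow_r Q = \neg_r P\vee Q$, $P\,\mathbf{wp}_r\,Q = \neg_r(P;\neg_r Q)$. For a predicate $s$ on $st$, a trace-valued expression $t$ over $st$ and a function $\sigma:\Sigma\to\Sigma$: $\mathcal{I}(s,t) = \mathbf{CRC}(s\Rightarrow_r\neg_r(t\le tt))$ and $\Phi(s,\sigma,t) = \mathbf{CRR}(s\wedge st'=\sigma(st)\wedge tt = t)$. For an expression $e$ over $st$, $\sigma\dagger e$ is $e$ with $st$ replaced by $\sigma(st)$.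 -}

module Defs where

open import Level using (Level; 0ℓ; Lift; lift) renaming (suc to lsuc)
open import Data.Bool using (Bool; true; false; T)
open import Data.List using (List; []; _++_; drop; length)
open import Data.Product using (Σ; ∃; _×_; _,_)
open import Data.Sum using (_⊎_)
open import Data.Empty using (⊥)
open import Data.Unit using (⊤)
open import Relation.Nullary using (¬_)
open import Relation.Unary using (Pred)
open import Relation.Binary.PropositionalEquality using (_≡_)

module UTP {E S : Set} where

  -- values of the (undecorated) observational variables;
  -- a relation relates an undashed valuation to a dashed one.
  record Vars : Set₁ where
    field
      ok   : Bool
      wait : Bool
      tr   : List E
      st   : S
      ref  : Pred E 0ℓ
  open Vars public

  Rel : Set₂
  Rel = Vars → Vars → Set₁

  ⌜_⌝ : Set → Set₁
  ⌜ A ⌝ = Lift (lsuc 0ℓ) A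

  _≤ₜ_ : List E → List E → Set
  xs ≤ₜ ys = ∃ λ d → ys ≡ xs ++ d

  _-ₜ_ : List E → List E → List E
  ys -ₜ xs = drop (length xs) ys

  tt : Vars → Vars → List E
  tt a b = tr b -ₜ tr a

  _≈ᵣ_ : Rel → Rel → Set₁
  P ≈ᵣ Q = ∀ a b → (P a b → Q a b) × (Q a b → P a b)

  falseᵣ : Rel
  falseᵣ _ _ = ⌜ ⊥ ⌝

  _∧ᵣ_ _∨ᵣ_ : Rel → Rel → Rel
  (P ∧ᵣ Q) a b = P a b × Q a b
  (P ∨ᵣ Q) a b = P a b ⊎ Q a b

  _⨾_ : Rel → Rel → Rel
  (P ⨾ Q) a b = Σ Vars λ m → P a m × Q m b

  R1 : Rel → Rel
  R1 P a b = P a b × ⌜ tr a ≤ₜ tr b ⌝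

  R2 : Rel → Rel
  R2 P a b =
    (⌜ tr a ≤ₜ tr b ⌝ × P (record a { tr = [] }) (record b { tr = tr b -ₜ tr a }))
    ⊎ (¬ ⌜ tr a ≤ₜ tr b ⌝ × P a b)

  RR : Rel → Rel
  RR P a b = Σ Bool λ o → Σ Bool λ o' → Σ Bool λ w → Σ Bool λ w' →
    R1 (R2 P) (record a { ok = o ; wait = w }) (record b { ok = o' ; wait = w' })

  trRev : Rel
  trRev a b = ⌜ tr b ≤ₜ tr a ⌝

  RC : Rel → Rel
  RC P = R1 (RR P ⨾ trRev)

  CRR : Rel → Rel
  CRR P a b = Σ (Pred E 0ℓ) λ r → RR P (record a { ref = r }) b

  CRC : Rel → Rel
  CRC P a b = Σ (Pred E 0ℓ) λ r → RC P (record a { ref = r }) b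

  trueᵣ : Rel
  trueᵣ = R1 (λ _ _ → ⌜ ⊤ ⌝)

  ¬ᵣ_ : Rel → Rel
  (¬ᵣ P) = R1 (λ a b → ¬ P a b)

  _⇒ᵣ_ : Rel → Rel → Rel
  P ⇒ᵣ Q = (¬ᵣ P) ∨ᵣ Q

  _wpᵣ_ : Rel → Rel → Rel
  P wpᵣ Q = ¬ᵣ (P ⨾ (¬ᵣ Q))

  SPred : Set
  SPred = S → Bool

  TExp : Set
  TExp = S → List E

  ⟦_⟧ : SPred → Rel
  ⟦ s ⟧ a b = ⌜ T (s (st a)) ⌝

  𝓘 : SPred → TExp → Rel
  𝓘 s t = CRC (⟦ s ⟧ ⇒ᵣ (¬ᵣ (λ a b → ⌜ t (st a) ≤ₜ tt a b ⌝)))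

  Φ : SPred → (S → S) → TExp → Rel
  Φ s σ t = CRR (λ a b → ⌜ T (s (st a)) ⌝ × ⌜ st b ≡ σ (st a) ⌝ × ⌜ tt a b ≡ t (st a) ⌝)


_†ₚ_ : {S : Set} → (S → S) → (S → Bool) → (S → Bool)
(σ †ₚ s) x = s (σ x)

_†ₜ_ : {E S : Set} → (S → S) → (S → List E) → (S → List E)
(σ †ₜ t) x = t (σ x)

{-# OPTIONS --safe #-}
-- Once the healthiness conditions and the hidden variables ok, wait, ref are
-- eliminated, 𝓘 s t is the relation Pending s t: the trace only grows and, if s
-- held initially, its increment does not yet begin with t. A step Φ s σ t fixes
-- the successor state and trace, so its weakest precondition is Pending at that
-- unique successor; the laws then reduce to Boolean identities on the guard and
-- to prefix arithmetic on traces.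
module Submission where

open import Defs
open import Data.Bool using (Bool; true; false; _∧_; _∨_; T)
open import Data.Bool.Properties using (T-∧; T-∨)
open import Data.List using (List; []; _∷_; _++_)
open import Data.List.Properties using (++-assoc; ++-identityʳ)
open import Data.Product using (_×_; _,_; proj₁; proj₂)
open import Data.Product.Function.NonDependent.Propositional using (_×-⇔_)
open import Data.Sum using (_⊎_; inj₁; inj₂; [_,_])
open import Data.Sum.Function.Propositional using (_⊎-⇔_)
open import Data.Empty using (⊥-elim)
open import Function using (_∘_)
open import Function.Bundles using (_⇔_; mk⇔; Equivalence)
open import Function.Properties.Equivalence using () renaming (trans to ⇔-trans; sym to ⇔-sym)
open import Level using (lift; lower)
open import Relation.Nullary using (¬_; yes; no)
open import Relation.Nullary.Decidable using (T?)
open import Relation.Binary.PropositionalEquality using (_≡_; refl; sym; trans; cong; subst)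

open Equivalence using (to; from)

module _ {E S : Set} where
  open UTP {E} {S}

  drop-length-++ : (xs ys : List E) → (xs ++ ys) -ₜ xs ≡ ys
  drop-length-++ []       ys = refl
  drop-length-++ (x ∷ xs) ys = drop-length-++ xs ys

  ≤ₜ-refl : (xs : List E) → xs ≤ₜ xs
  ≤ₜ-refl xs = [] , sym (++-identityʳ xs)

  ≤ₜ-trans : {xs ys zs : List E} → xs ≤ₜ ys → ys ≤ₜ zs → xs ≤ₜ zs
  ≤ₜ-trans {xs} (d , refl) (e , refl) = d ++ e , ++-assoc xs d e

  ++-≤ₜ⇒≤ₜˡ : {xs ys zs : List E} → (xs ++ ys) ≤ₜ zs → xs ≤ₜ zs
  ++-≤ₜ⇒≤ₜˡ {xs} {ys} (d , refl) = ys ++ d , ++-assoc xs ys d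

  ≤ₜ⇒≡++-ₜ : {xs ys : List E} → xs ≤ₜ ys → ys ≡ xs ++ (ys -ₜ xs)
  ≤ₜ⇒≡++-ₜ {xs} (d , refl) = cong (xs ++_) (sym (drop-length-++ xs d))

  ++-≤ₜ⇒≤ₜ-ₜ : {xs ys zs : List E} → (xs ++ ys) ≤ₜ zs → ys ≤ₜ (zs -ₜ xs)
  ++-≤ₜ⇒≤ₜ-ₜ {xs} {ys} (d , refl) =
    d , trans (cong (_-ₜ xs) (++-assoc xs ys d)) (drop-length-++ xs (ys ++ d))

  ≤ₜ-ₜ⇒++-≤ₜ : {xs ys zs : List E} → xs ≤ₜ zs → ys ≤ₜ (zs -ₜ xs) → (xs ++ ys) ≤ₜ zs
  ≤ₜ-ₜ⇒++-≤ₜ {xs} {ys} xs≤zs (d , eq) =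
    d , trans (≤ₜ⇒≡++-ₜ xs≤zs) (trans (cong (xs ++_) eq) (sym (++-assoc xs ys d)))

  ++-≤ₜ-ₜ⇔ : {xs ys zs ws : List E} →
             (xs ++ ys) ≤ₜ zs → ws ≤ₜ (zs -ₜ (xs ++ ys)) ⇔ (ys ++ ws) ≤ₜ (zs -ₜ xs)
  ++-≤ₜ-ₜ⇔ {xs} {ys} {zs} {ws} xs++ys≤zs = mk⇔
    (++-≤ₜ⇒≤ₜ-ₜ {xs} ∘ subst (_≤ₜ zs) (++-assoc xs ys ws) ∘ ≤ₜ-ₜ⇒++-≤ₜ xs++ys≤zs)
    (++-≤ₜ⇒≤ₜ-ₜ {xs ++ ys} ∘ subst (_≤ₜ zs) (sym (++-assoc xs ys ws))
      ∘ ≤ₜ-ₜ⇒++-≤ₜ {xs} (++-≤ₜ⇒≤ₜˡ xs++ys≤zs))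

  ≤ₜ-ₜ-mono : {xs ys zs ws : List E} →
              xs ≤ₜ zs → zs ≤ₜ ws → ys ≤ₜ (zs -ₜ xs) → ys ≤ₜ (ws -ₜ xs)
  ≤ₜ-ₜ-mono xs≤zs zs≤ws = ++-≤ₜ⇒≤ₜ-ₜ ∘ (λ p → ≤ₜ-trans p zs≤ws) ∘ ≤ₜ-ₜ⇒++-≤ₜ xs≤zs

  Pending : SPred → TExp → Vars → Vars → Set
  Pending s t a b = tr a ≤ₜ tr b × (T (s (st a)) → ¬ t (st a) ≤ₜ tt a b)

  Step : SPred → (S → S) → TExp → Vars → Vars → Set
  Step s σ t a m = T (s (st a)) × st m ≡ σ (st a) × tr m ≡ tr a ++ t (st a)

  𝓘⇔Pending : ∀ s t a b → 𝓘 s t a b ⇔ Pending s t a b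
  𝓘⇔Pending s t a b = mk⇔ elim intro
    where
    elim : 𝓘 s t a b → Pending s t a b
    elim (_ , (_ , (_ , _ , _ , _ , inj₁ (_ , inj₁ (¬s , _)) , _) , _) , lift a≤b) =
      a≤b , λ s-holds → ⊥-elim (¬s (lift s-holds))
    elim (_ , (_ , (_ , _ , _ , _ , inj₁ (_ , inj₂ (¬t , _)) , _) , lift b≤m) , lift a≤b) =
      a≤b , λ _ t≤tt → ¬t (lift (≤ₜ-ₜ-mono a≤b b≤m t≤tt))
    elim (_ , (_ , (_ , _ , _ , _ , inj₂ (a≰m , _) , a≤m) , _) , _) = ⊥-elim (a≰m a≤m)

    intro : Pending s t a b → 𝓘 s t a b
    intro (a≤b , h) =
      -- the trailing tr' ≤ tr of RC is met by taking b itself as intermediate observation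
      ref a , (b , (true , true , true , true , inj₁ (lift a≤b , body) , lift a≤b)
                 , lift (≤ₜ-refl (tr b))) , lift a≤b
      where
      body : (⟦ s ⟧ ⇒ᵣ (¬ᵣ λ x y → ⌜ t (st x) ≤ₜ tt x y ⌝))
               (record a { tr = [] }) (record b { tr = tt a b })
      body with T? (s (st a))
      ... | no ¬s       = inj₁ ((¬s ∘ lower) , lift (_ , refl))
      ... | yes s-holds = inj₂ ((h s-holds ∘ lower) , lift (_ , refl))

  Φ⇔Step : ∀ s σ t a m → Φ s σ t a m ⇔ Step s σ t a m
  Φ⇔Step s σ t a m = mk⇔ elim intro
    where
    elim : Φ s σ t a m → Step s σ t a m
    elim (_ , _ , _ , _ , _ , inj₁ (lift a≤m , lift s-holds , lift st≡ , lift tt≡) , _) =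
      s-holds , st≡ , trans (≤ₜ⇒≡++-ₜ a≤m) (cong (tr a ++_) tt≡)
    elim (_ , _ , _ , _ , _ , inj₂ (a≰m , _) , a≤m) = ⊥-elim (a≰m a≤m)

    intro : Step s σ t a m → Φ s σ t a m
    intro (s-holds , st≡ , tr≡) =
      ref a , true , true , true , true
            , inj₁ (lift a≤m , lift s-holds , lift st≡ , lift tt≡) , lift a≤m
      where
      a≤m : tr a ≤ₜ tr m
      a≤m = t (st a) , tr≡
      tt≡ : tt a m ≡ t (st a)
      tt≡ = trans (cong (_-ₜ tr a) tr≡) (drop-length-++ (tr a) (t (st a)))

  Φ-wp-false⇔Pending : ∀ s σ t a b → (Φ s σ t wpᵣ falseᵣ) a b ⇔ Pending s t a b
  Φ-wp-false⇔Pending s σ t a b = mk⇔ elim intro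
    where
    elim : (Φ s σ t wpᵣ falseᵣ) a b → Pending s t a b
    elim (no-step , lift a≤b) = a≤b , λ s-holds t≤tt →
      no-step ( next
              , from (Φ⇔Step s σ t a next) (s-holds , refl , refl)
              , lower
              , lift (≤ₜ-ₜ⇒++-≤ₜ a≤b t≤tt) )
      where
      next : Vars
      next = record b { st = σ (st a) ; tr = tr a ++ t (st a) }

    intro : Pending s t a b → (Φ s σ t wpᵣ falseᵣ) a b
    intro (a≤b , h) = no-step , lift a≤b
      where
      no-step : ¬ (Φ s σ t ⨾ (¬ᵣ falseᵣ)) a b
      no-step (m , φ , _ , lift m≤b) with to (Φ⇔Step s σ t a m) φ
      ... | s-holds , _ , tr≡ = h s-holds (++-≤ₜ⇒≤ₜ-ₜ (subst (_≤ₜ tr b) tr≡ m≤b))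

  Φ-wp-𝓘⇔Pending : ∀ s₁ s₂ σ t₁ t₂ a b →
    (Φ s₁ σ t₁ wpᵣ 𝓘 s₂ t₂) a b
      ⇔ Pending (λ x → s₁ x ∧ (σ †ₚ s₂) x) (λ x → t₁ x ++ (σ †ₜ t₂) x) a b
  Φ-wp-𝓘⇔Pending s₁ s₂ σ t₁ t₂ a b = mk⇔ elim intro
    where
    elim : (Φ s₁ σ t₁ wpᵣ 𝓘 s₂ t₂) a b →
           Pending (λ x → s₁ x ∧ (σ †ₚ s₂) x) (λ x → t₁ x ++ (σ †ₜ t₂) x) a b
    elim (no-step , lift a≤b) = a≤b , λ s-holds t≤tt →
      let (s₁-holds , s₂-holds) = to (T-∧ {s₁ (st a)}) s-holds
          next : Vars
          next = record b { st = σ (st a) ; tr = tr a ++ t₁ (st a) }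
          not-pending : ¬ 𝓘 s₂ t₂ next b
          not-pending i = let (next≤b , h) = to (𝓘⇔Pending s₂ t₂ next b) i
                          in h s₂-holds (from (++-≤ₜ-ₜ⇔ next≤b) t≤tt)
      in no-step ( next
                 , from (Φ⇔Step s₁ σ t₁ a next) (s₁-holds , refl , refl)
                 , not-pending
                 , lift (≤ₜ-ₜ⇒++-≤ₜ a≤b (++-≤ₜ⇒≤ₜˡ t≤tt)) )

    intro : Pending (λ x → s₁ x ∧ (σ †ₚ s₂) x) (λ x → t₁ x ++ (σ †ₜ t₂) x) a b →
            (Φ s₁ σ t₁ wpᵣ 𝓘 s₂ t₂) a b
    intro (a≤b , h) = no-step , lift a≤b
      where
      after : ∀ {x ys} → x ≡ σ (st a) → ys ≡ tr a ++ t₁ (st a) → ys ≤ₜ tr b →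
              T (s₁ (st a)) → T (s₂ x) → ¬ t₂ x ≤ₜ (tr b -ₜ ys)
      after refl refl ys≤b s₁-holds s₂-holds t₂≤ =
        h (from (T-∧ {s₁ (st a)}) (s₁-holds , s₂-holds)) (to (++-≤ₜ-ₜ⇔ ys≤b) t₂≤)

      no-step : ¬ (Φ s₁ σ t₁ ⨾ (¬ᵣ 𝓘 s₂ t₂)) a b
      no-step (m , φ , (not-pending , lift m≤b)) with to (Φ⇔Step s₁ σ t₁ a m) φ
      ... | s₁-holds , st≡ , tr≡ =
        not-pending (from (𝓘⇔Pending s₂ t₂ m b) (m≤b , after st≡ tr≡ m≤b s₁-holds))

  Pending-∨ : ∀ s₁ s₂ t a b →
    (Pending s₁ t a b × Pending s₂ t a b) ⇔ Pending (λ x → s₁ x ∨ s₂ x) t a b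
  Pending-∨ s₁ s₂ t a b = mk⇔
    (λ ((a≤b , h₁) , (_ , h₂)) → a≤b , [ h₁ , h₂ ] ∘ to (T-∨ {s₁ (st a)}))
    (λ (a≤b , h) → (a≤b , h ∘ from (T-∨ {s₁ (st a)}) ∘ inj₁)
                 , (a≤b , h ∘ from (T-∨ {s₁ (st a)}) ∘ inj₂))

  Pending-∧ : ∀ s₁ s₂ t a b →
    (Pending s₁ t a b ⊎ Pending s₂ t a b) ⇔ Pending (λ x → s₁ x ∧ s₂ x) t a b
  Pending-∧ s₁ s₂ t a b = mk⇔
    [ (λ (a≤b , h₁) → a≤b , h₁ ∘ proj₁ ∘ to (T-∧ {s₁ (st a)}))
    , (λ (a≤b , h₂) → a≤b , h₂ ∘ proj₂ ∘ to (T-∧ {s₁ (st a)})) ]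
    split
    where
    split : Pending (λ x → s₁ x ∧ s₂ x) t a b → Pending s₁ t a b ⊎ Pending s₂ t a b
    split (a≤b , h) with T? (s₁ (st a))
    ... | no ¬s₁       = inj₁ (a≤b , ⊥-elim ∘ ¬s₁)
    ... | yes s₁-holds =
      inj₂ (a≤b , λ s₂-holds → h (from (T-∧ {s₁ (st a)}) (s₁-holds , s₂-holds)))

  ≈ᵣ-via : {P Q : Rel} (C : Vars → Vars → Set) →
           (∀ a b → P a b ⇔ C a b) → (∀ a b → Q a b ⇔ C a b) → P ≈ᵣ Q
  ≈ᵣ-via {P} {Q} C P⇔C Q⇔C a b = to P⇔Q , from P⇔Q
    where
    P⇔Q : P a b ⇔ Q a b
    P⇔Q = ⇔-trans (P⇔C a b) (⇔-sym (Q⇔C a b))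

  Φ-wp-false : ∀ s σ t → (Φ s σ t wpᵣ falseᵣ) ≈ᵣ 𝓘 s t
  Φ-wp-false s σ t = ≈ᵣ-via (Pending s t) (Φ-wp-false⇔Pending s σ t) (𝓘⇔Pending s t)

  Φ-wp-𝓘 : ∀ s₁ s₂ σ t₁ t₂ →
    (Φ s₁ σ t₁ wpᵣ 𝓘 s₂ t₂) ≈ᵣ 𝓘 (λ x → s₁ x ∧ (σ †ₚ s₂) x) (λ x → t₁ x ++ (σ †ₜ t₂) x)
  Φ-wp-𝓘 s₁ s₂ σ t₁ t₂ =
    ≈ᵣ-via (Pending s t) (Φ-wp-𝓘⇔Pending s₁ s₂ σ t₁ t₂) (𝓘⇔Pending s t)
    where
    s : SPred
    s x = s₁ x ∧ (σ †ₚ s₂) x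
    t : TExp
    t x = t₁ x ++ (σ †ₜ t₂) x

  𝓘-false : ∀ t → 𝓘 (λ _ → false) t ≈ᵣ trueᵣ
  𝓘-false t a b =
    (λ i → lift _ , lift (proj₁ (to (𝓘⇔Pending _ t a b) i))) ,
    (λ (_ , lift a≤b) → from (𝓘⇔Pending _ t a b) (a≤b , λ ()))

  𝓘-true-[] : 𝓘 (λ _ → true) (λ _ → []) ≈ᵣ falseᵣ
  𝓘-true-[] a b =
    (λ i → ⊥-elim (proj₂ (to (𝓘⇔Pending _ _ a b) i) _ (_ , refl))) ,
    (λ ())

  𝓘-∧-𝓘 : ∀ s₁ s₂ t → (𝓘 s₁ t ∧ᵣ 𝓘 s₂ t) ≈ᵣ 𝓘 (λ x → s₁ x ∨ s₂ x) t
  𝓘-∧-𝓘 s₁ s₂ t = ≈ᵣ-via (Pending (λ x → s₁ x ∨ s₂ x) t)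
    (λ a b → ⇔-trans (𝓘⇔Pending s₁ t a b ×-⇔ 𝓘⇔Pending s₂ t a b) (Pending-∨ s₁ s₂ t a b))
    (𝓘⇔Pending _ t)

  𝓘-∨-𝓘 : ∀ s₁ s₂ t → (𝓘 s₁ t ∨ᵣ 𝓘 s₂ t) ≈ᵣ 𝓘 (λ x → s₁ x ∧ s₂ x) t
  𝓘-∨-𝓘 s₁ s₂ t = ≈ᵣ-via (Pending (λ x → s₁ x ∧ s₂ x) t)
    (λ a b → ⇔-trans (𝓘⇔Pending s₁ t a b ⊎-⇔ 𝓘⇔Pending s₂ t a b) (Pending-∧ s₁ s₂ t a b))
    (𝓘⇔Pending _ t)

open UTP

theorem16 : {E S : Set} →
    (∀ (s : S → Bool) (σ : S → S) (t : S → List E) →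
        (Φ s σ t wpᵣ falseᵣ) ≈ᵣ 𝓘 s t) ×
    (∀ (s₁ s₂ : S → Bool) (σ : S → S) (t₁ t₂ : S → List E) →
        (Φ s₁ σ t₁ wpᵣ 𝓘 s₂ t₂)
          ≈ᵣ 𝓘 (λ x → s₁ x ∧ (σ †ₚ s₂) x) (λ x → t₁ x ++ (σ †ₜ t₂) x)) ×
    (∀ (t : S → List E) → 𝓘 (λ _ → false) t ≈ᵣ trueᵣ {E} {S}) ×
    (𝓘 {E} {S} (λ _ → true) (λ _ → []) ≈ᵣ falseᵣ) ×
    (∀ (s₁ s₂ : S → Bool) (t : S → List E) →
        (𝓘 s₁ t ∧ᵣ 𝓘 s₂ t) ≈ᵣ 𝓘 (λ x → s₁ x ∨ s₂ x) t) ×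
    (∀ (s₁ s₂ : S → Bool) (t : S → List E) →
        (𝓘 s₁ t ∨ᵣ 𝓘 s₂ t) ≈ᵣ 𝓘 (λ x → s₁ x ∧ s₂ x) t)
theorem16 = Φ-wp-false , Φ-wp-𝓘 , 𝓘-false , 𝓘-true-[] , 𝓘-∧-𝓘 , 𝓘-∨-𝓘
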